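{- Let $D=(E,\mathcal{F})$ be a delta-matroid. Then there exists a sequence of elements $e_1,e_2,\dots,e_k$ of $E$ such that \begin{enumerate} \item $\{e_1,e_2,\dots,e_k\}\in\mathcal{F}$; \item $\omega(D\,\Delta\,\{e_1,e_2,\dots,e_k\})=\partial\omega_M(D)$; \item the sequence of twist widths \[ \omega(D),\ \omega(D\,\Delta\,\{e_1\}),\ \omega(D\,\Delta\,\{e_1,e_2\}),\ \dots,\ \omega(D\,\Delta\,\{e_1,e_2,\dots,e_k\}) \] is non-decreasing (and hence rises monotonically to $\partial\omega_M(D)$). \end{enumerate}
   Context: A set system is a pair $D=(E,\mathcal{F})$ where $E$ is a finite set and $\mathcal{F}$ is a collection of subsets of $E$ (feasible sets). A delta-matroid is a set system with $\mathcal{F}\neq\emptyset$ satisfying the symmetric exchange axiom: for any $X,Y\in\mathcal{F}$ and any $u\in X\,\Delta\, Y$, there exists $v\in X\,\Delta\, Y$ (possibly $v=u$) such that $X\,\Delta\,\{u,v\}\in\mathcal{F}$, where $\Delta$ denotes symmetric difference. For $A\subseteq E$, the twist is $D\,\Delta\, A=(E,\{X\,\Delta\, A: X\in\mathcal{F}\})$. With $r_{\max}(D)$, $r_{\min}(D)$ the maximum and minimum cardinalities of feasible sets, the width is $\omega(D)=r_{\max}(D)-r_{\min}(D)$, and the maximum twist width is $\partial\omega_M(D)=\max\{\omega(D\,\Delta\, A): A\subseteq E\}$. -}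

module Defs where

open import Data.Nat using (ℕ; zero; suc; _∸_; _⊔_; _⊓_)
open import Data.Bool using (Bool; true; false; _xor_)
open import Data.Fin using (Fin)
open import Data.Fin.Subset using (Subset; ⁅_⁆; _∪_; ∣_∣; _∈_; ⊥)
open import Data.Vec using (Vec; []; _∷_; zipWith)
open import Data.List using (List; []; _∷_; map; foldr; _++_)
open import Data.List.Membership.Propositional using () renaming (_∈_ to _∈ₗ_)
open import Data.List.Relation.Unary.Any using (Any)
open import Data.Product using (Σ; _×_; ∃)
open import Relation.Binary.PropositionalEquality using (_≡_; _≢_)

-- Ground set E is Fin n; subsets of E are Data.Fin.Subset.Subset n.
-- A set system on Fin n: a finite list of feasible sets (the collection 𝓕).
SetSystem : ℕ → Set
SetSystem n = List (Subset n)

_Δ_ : {n : ℕ} → Subset n → Subset n → Subset n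
_Δ_ = zipWith _xor_

infixl 6 _Δ_

Feasible : {n : ℕ} → SetSystem n → Subset n → Set
Feasible 𝓕 X = X ∈ₗ 𝓕

IsDeltaMatroid : {n : ℕ} → SetSystem n → Set
IsDeltaMatroid {n} 𝓕 =
  (∃ λ X → Feasible 𝓕 X) ×
  ((X Y : Subset n) → Feasible 𝓕 X → Feasible 𝓕 Y →
    (u : Fin n) → u ∈ (X Δ Y) →
    Σ (Fin n) λ v → v ∈ (X Δ Y) × Feasible 𝓕 (X Δ (⁅ u ⁆ ∪ ⁅ v ⁆)))

twist : {n : ℕ} → SetSystem n → Subset n → SetSystem n
twist 𝓕 A = map (λ X → X Δ A) 𝓕

-- r_max and r_min (meaningful for nonempty 𝓕; r_min of [] defaults to n)
rmax : {n : ℕ} → SetSystem n → ℕ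
rmax 𝓕 = foldr (λ X m → ∣ X ∣ ⊔ m) 0 𝓕

rmin : {n : ℕ} → SetSystem n → ℕ
rmin {n} 𝓕 = foldr (λ X m → ∣ X ∣ ⊓ m) n 𝓕

width : {n : ℕ} → SetSystem n → ℕ
width 𝓕 = rmax 𝓕 ∸ rmin 𝓕

allSubsets : (n : ℕ) → List (Subset n)
allSubsets zero = [] ∷ []
allSubsets (suc n) = map (true ∷_) (allSubsets n) ++ map (false ∷_) (allSubsets n)

maxTwistWidth : {n : ℕ} → SetSystem n → ℕ
maxTwistWidth {n} 𝓕 = foldr (λ A m → width (twist 𝓕 A) ⊔ m) 0 (allSubsets n)

setOf : {n : ℕ} → List (Fin n) → Subset n
setOf = foldr (λ e S → ⁅ e ⁆ ∪ S) ⊥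

-- Write ωΔ A for the width of the twist D Δ A. Replacing A by A Δ {e} changes the size of every
-- twisted feasible set by exactly one, so ωΔ does not decrease if e lies in some smallest
-- feasible set of D Δ A or avoids some largest one; call such an e non-narrowing for A.
-- Fix a feasible X of maximum twist width: if D Δ A is a widest twist and Z Δ A a smallest
-- feasible set of it, the triangle inequality for ∣ _ Δ _ ∣ shows that X = Z qualifies.
-- Starting from A = ∅, add non-narrowing elements of X ∖ A one at a time. When none is left,
-- every smallest feasible set of D Δ A avoids X Δ A and every largest one contains it. By the
-- exchange axiom some smallest set lies inside X Δ A, so it is empty and A is feasible; and for
-- a largest set Y Δ X of D Δ X some largest W Δ A contains Y Δ A, hence also
-- Y Δ X = (Y Δ A) Δ (X Δ A), so ωΔ X ≤ ωΔ A. The elements added so far form the sequence.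

module Submission where

open import Defs
open import Algebra.Definitions using (Selective)
open import Data.Bool using (true; false)
open import Data.Bool.Properties
  using (xor-assoc; xor-comm; xor-identityˡ; xor-identityʳ; xor-same; not-distribʳ-xor)
open import Data.Empty using (⊥-elim)
open import Data.Fin using (Fin; _≟_)
open import Data.Fin.Properties using (any?)
open import Data.Fin.Subset using (Subset; _∈_; _∉_; _⊆_; ⁅_⁆; _∪_; ∁; ∣_∣; ⊥; Empty)
open import Data.Fin.Subset.Properties
  using ( drop-there; x≢y⇒x∉⁅y⁆; x∈⁅y⁆⇒x≡y; _∈?_; Empty-unique; ∣p∣≤n; ∣⊥∣≡0
        ; ∣∁p∣≡n∸∣p∣; ∁p⊆∁q⇒p⊇q; p⊆q⇒∣p∣≤∣q∣; ⊥⊆; x∈⁅x⁆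
        ; p⊆p∪q; q⊆p∪q; x∈p∪q⁻; ∪-idem; ∪-assoc; ∪-identityˡ; ∪-identityʳ)
open import Data.List using (List; []; _∷_; foldr; map; length; take)
open import Data.List.Membership.Propositional using (find; lose) renaming (_∈_ to _∈ₗ_)
open import Data.List.Membership.Propositional.Properties using (∈-map⁺; ∈-map⁻; ∈-++⁺ˡ; ∈-++⁺ʳ)
open import Data.List.Relation.Unary.All as All using (All; []; _∷_)
open import Data.List.Relation.Unary.Any using (here; there) renaming (any? to anyₗ?)
open import Data.List.Relation.Unary.Unique.Propositional using (Unique)
open import Data.List.Relation.Unary.AllPairs using ([]; _∷_)
open import Data.Nat using (ℕ; zero; suc; _+_; _∸_; _⊔_; _⊓_; _≤_; _<_; z≤n; s≤s)
open import Data.Nat.Induction using (<-wellFounded)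
open import Data.Nat.Properties
  using ( ≤-trans; ≤-reflexive; ≤-antisym; n≤1+n; n≤0⇒n≡0; +-suc; +-monoʳ-≤
        ; ∸-mono; ∸-cancelʳ-≤; m≤n+o⇒m∸n≤o; +-comm; n<1+n; 1+n≰n
        ; ⊔-sel; ⊓-sel; m≤m⊔n; m≤n⊔m; m⊓n≤m; m⊓n≤n; module ≤-Reasoning)
  renaming (_≟_ to _≟ℕ_)
open import Data.Product using (Σ; ∃; _×_; _,_; proj₁; proj₂)
open import Data.Sum using (_⊎_; inj₁; inj₂)
open import Data.Vec using ([]; _∷_; here; there)
open import Data.Vec.Properties using (zipWith-assoc; zipWith-comm; zipWith-identityˡ; zipWith-identityʳ)
open import Induction.WellFounded using (Acc; acc)
open import Function using (_∘_)
open import Relation.Binary.PropositionalEquality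
open import Relation.Nullary using (¬_; Dec; yes; no)
open import Relation.Nullary.Decidable using (_×-dec_; _⊎-dec_; ¬?; map′; decidable-stable)

private
  variable
    n : ℕ
    p q r : Subset n
    x y : Fin n

Δ-assoc : ∀ (p q r : Subset n) → (p Δ q) Δ r ≡ p Δ (q Δ r)
Δ-assoc = zipWith-assoc xor-assoc

Δ-comm : ∀ (p q : Subset n) → p Δ q ≡ q Δ p
Δ-comm = zipWith-comm xor-comm

Δ-identityˡ : ∀ (p : Subset n) → ⊥ Δ p ≡ p
Δ-identityˡ = zipWith-identityˡ xor-identityˡ

Δ-identityʳ : ∀ (p : Subset n) → p Δ ⊥ ≡ p
Δ-identityʳ = zipWith-identityʳ xor-identityʳ

Δ-self : ∀ (p : Subset n) → p Δ p ≡ ⊥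
Δ-self []      = refl
Δ-self (b ∷ p) = cong₂ _∷_ (xor-same b) (Δ-self p)

Δ-swap : ∀ (p q r : Subset n) → (p Δ q) Δ r ≡ (p Δ r) Δ q
Δ-swap p q r = begin
  (p Δ q) Δ r  ≡⟨ Δ-assoc p q r ⟩
  p Δ (q Δ r)  ≡⟨ cong (p Δ_) (Δ-comm q r) ⟩
  p Δ (r Δ q)  ≡⟨ Δ-assoc p r q ⟨
  (p Δ r) Δ q  ∎
  where open ≡-Reasoning

Δ-cancel-middle : ∀ (p q r : Subset n) → (p Δ q) Δ (q Δ r) ≡ p Δ r
Δ-cancel-middle p q r = begin
  (p Δ q) Δ (q Δ r)  ≡⟨ Δ-assoc p q (q Δ r) ⟩
  p Δ (q Δ (q Δ r))  ≡⟨ cong (p Δ_) (Δ-assoc q q r) ⟨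
  p Δ ((q Δ q) Δ r)  ≡⟨ cong (λ s → p Δ (s Δ r)) (Δ-self q) ⟩
  p Δ (⊥ Δ r)        ≡⟨ cong (p Δ_) (Δ-identityˡ r) ⟩
  p Δ r              ∎
  where open ≡-Reasoning

Δ-cancelʳ : ∀ (p q r : Subset n) → (p Δ r) Δ (q Δ r) ≡ p Δ q
Δ-cancelʳ p q r = trans (cong ((p Δ r) Δ_) (Δ-comm q r)) (Δ-cancel-middle p r q)

Δ≡⊥⇒≡ : ∀ (p q : Subset n) → p Δ q ≡ ⊥ → p ≡ q
Δ≡⊥⇒≡ p q pΔq≡⊥ = begin
  p                  ≡⟨ Δ-identityʳ p ⟨
  p Δ ⊥              ≡⟨ cong (p Δ_) (Δ-self q) ⟨
  p Δ (q Δ q)        ≡⟨ Δ-assoc p q q ⟨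
  (p Δ q) Δ q        ≡⟨ cong (_Δ q) pΔq≡⊥ ⟩
  ⊥ Δ q              ≡⟨ Δ-identityˡ q ⟩
  q                  ∎
  where open ≡-Reasoning

Δ-∁ : ∀ (p q : Subset n) → p Δ ∁ q ≡ ∁ (p Δ q)
Δ-∁ []      []      = refl
Δ-∁ (b ∷ p) (c ∷ q) = cong₂ _∷_ (sym (not-distribʳ-xor b c)) (Δ-∁ p q)

x∈pΔq⁻ : ∀ (p q : Subset n) → x ∈ p Δ q → (x ∈ p × x ∉ q) ⊎ (x ∉ p × x ∈ q)
x∈pΔq⁻ (_     ∷ p) (_     ∷ q) (there x∈) with x∈pΔq⁻ p q x∈
... | inj₁ (x∈p , x∉q) = inj₁ (there x∈p , x∉q ∘ drop-there)
... | inj₂ (x∉p , x∈q) = inj₂ (x∉p ∘ drop-there , there x∈q)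
x∈pΔq⁻ (true  ∷ p) (false ∷ q) here = inj₁ (here , λ ())
x∈pΔq⁻ (false ∷ p) (true  ∷ q) here = inj₂ ((λ ()) , here)

x∈p∧x∉q⇒x∈pΔq : ∀ (p q : Subset n) → x ∈ p → x ∉ q → x ∈ p Δ q
x∈p∧x∉q⇒x∈pΔq (true ∷ p) (true  ∷ q) here      x∉q = ⊥-elim (x∉q here)
x∈p∧x∉q⇒x∈pΔq (true ∷ p) (false ∷ q) here      x∉q = here
x∈p∧x∉q⇒x∈pΔq (_    ∷ p) (_     ∷ q) (there x∈p) x∉q =
  there (x∈p∧x∉q⇒x∈pΔq p q x∈p (x∉q ∘ there))

p⊆r∧q⊆r⇒pΔq⊆r : ∀ (p q : Subset n) → p ⊆ r → q ⊆ r → p Δ q ⊆ r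
p⊆r∧q⊆r⇒pΔq⊆r p q p⊆r q⊆r x∈ with x∈pΔq⁻ p q x∈
... | inj₁ (x∈p , _) = p⊆r x∈p
... | inj₂ (_ , x∈q) = q⊆r x∈q

disjoint⇒∪≡Δ : ∀ (p q : Subset n) → (∀ {x} → x ∈ p → x ∉ q) → p ∪ q ≡ p Δ q
disjoint⇒∪≡Δ []           []      _        = refl
disjoint⇒∪≡Δ (true  ∷ p) (true  ∷ q) disjoint = ⊥-elim (disjoint here here)
disjoint⇒∪≡Δ (true  ∷ p) (false ∷ q) disjoint =
  cong (true ∷_) (disjoint⇒∪≡Δ p q λ x∈p x∈q → disjoint (there x∈p) (there x∈q))
disjoint⇒∪≡Δ (false ∷ p) (b     ∷ q) disjoint =
  cong (b ∷_) (disjoint⇒∪≡Δ p q λ x∈p x∈q → disjoint (there x∈p) (there x∈q))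

x≢y⇒⁅x⁆∪⁅y⁆≡⁅x⁆Δ⁅y⁆ : x ≢ y → ⁅ x ⁆ ∪ ⁅ y ⁆ ≡ ⁅ x ⁆ Δ ⁅ y ⁆
x≢y⇒⁅x⁆∪⁅y⁆≡⁅x⁆Δ⁅y⁆ {x = x} {y} x≢y = disjoint⇒∪≡Δ ⁅ x ⁆ ⁅ y ⁆ λ z∈⁅x⁆ z∈⁅y⁆ →
  x≢y (trans (sym (x∈⁅y⁆⇒x≡y x z∈⁅x⁆)) (x∈⁅y⁆⇒x≡y y z∈⁅y⁆))

⊆-or-witness : ∀ (p q : Subset n) → p ⊆ q ⊎ ∃ λ x → x ∈ p × x ∉ q
⊆-or-witness p q with any? (λ x → x ∈? p ×-dec ¬? (x ∈? q))
... | yes witness = inj₂ witness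
... | no  ∄x      = inj₁ λ {x} x∈p → decidable-stable (x ∈? q) λ x∉q → ∄x (x , x∈p , x∉q)

∣pΔ∁q∣≡n∸∣pΔq∣ : ∀ (p q : Subset n) → ∣ p Δ ∁ q ∣ ≡ n ∸ ∣ p Δ q ∣
∣pΔ∁q∣≡n∸∣pΔq∣ p q = trans (cong ∣_∣ (Δ-∁ p q)) (∣∁p∣≡n∸∣p∣ (p Δ q))

p⊆q∧x∈qΔp⇒x∈q∧x∉p : p ⊆ q → x ∈ q Δ p → x ∈ q × x ∉ p
p⊆q∧x∈qΔp⇒x∈q∧x∉p {p = p} {q} p⊆q x∈ with x∈pΔq⁻ q p x∈
... | inj₁ x∈q×x∉p   = x∈q×x∉p
... | inj₂ (x∉q , x∈p) = ⊥-elim (x∉q (p⊆q x∈p))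

x∉p⇒p∪⁅x⁆≡pΔ⁅x⁆ : ∀ (p : Subset n) → x ∉ p → p ∪ ⁅ x ⁆ ≡ p Δ ⁅ x ⁆
x∉p⇒p∪⁅x⁆≡pΔ⁅x⁆ {x = x} p x∉p = disjoint⇒∪≡Δ p ⁅ x ⁆ λ y∈p y∈⁅x⁆ →
  x∉p (subst (_∈ p) (x∈⁅y⁆⇒x≡y x y∈⁅x⁆) y∈p)

p⊆q∧x∈q⇒p∪⁅x⁆⊆q : p ⊆ q → x ∈ q → p ∪ ⁅ x ⁆ ⊆ q
p⊆q∧x∈q⇒p∪⁅x⁆⊆q {p = p} {x = x} p⊆q x∈q y∈ with x∈p∪q⁻ p ⁅ x ⁆ y∈
... | inj₁ y∈p    = p⊆q y∈p
... | inj₂ y∈⁅x⁆ = subst (_∈ _) (sym (x∈⁅y⁆⇒x≡y x y∈⁅x⁆)) x∈q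

x∈p⇒suc∣pΔ⁅x⁆∣≡∣p∣ : ∀ (p : Subset n) → x ∈ p → suc ∣ p Δ ⁅ x ⁆ ∣ ≡ ∣ p ∣
x∈p⇒suc∣pΔ⁅x⁆∣≡∣p∣ (true  ∷ p) here        = cong (suc ∘ ∣_∣) (Δ-identityʳ p)
x∈p⇒suc∣pΔ⁅x⁆∣≡∣p∣ (true  ∷ p) (there x∈p) = cong suc (x∈p⇒suc∣pΔ⁅x⁆∣≡∣p∣ p x∈p)
x∈p⇒suc∣pΔ⁅x⁆∣≡∣p∣ (false ∷ p) (there x∈p) = x∈p⇒suc∣pΔ⁅x⁆∣≡∣p∣ p x∈p

x∉p⇒∣pΔ⁅x⁆∣≡suc∣p∣ : ∀ (p : Subset n) {x} → x ∉ p → ∣ p Δ ⁅ x ⁆ ∣ ≡ suc ∣ p ∣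
x∉p⇒∣pΔ⁅x⁆∣≡suc∣p∣ (true  ∷ p) {Fin.zero}  x∉p = ⊥-elim (x∉p here)
x∉p⇒∣pΔ⁅x⁆∣≡suc∣p∣ (false ∷ p) {Fin.zero}  x∉p = cong (suc ∘ ∣_∣) (Δ-identityʳ p)
x∉p⇒∣pΔ⁅x⁆∣≡suc∣p∣ (true  ∷ p) {Fin.suc x} x∉p = cong suc (x∉p⇒∣pΔ⁅x⁆∣≡suc∣p∣ p (x∉p ∘ there))
x∉p⇒∣pΔ⁅x⁆∣≡suc∣p∣ (false ∷ p) {Fin.suc x} x∉p = x∉p⇒∣pΔ⁅x⁆∣≡suc∣p∣ p (x∉p ∘ there)

∣pΔq∣≤∣p∣+∣q∣ : ∀ (p q : Subset n) → ∣ p Δ q ∣ ≤ ∣ p ∣ + ∣ q ∣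
∣pΔq∣≤∣p∣+∣q∣ []          []          = z≤n
∣pΔq∣≤∣p∣+∣q∣ (true  ∷ p) (true  ∷ q) =
  ≤-trans (∣pΔq∣≤∣p∣+∣q∣ p q) (≤-trans (+-monoʳ-≤ ∣ p ∣ (n≤1+n ∣ q ∣)) (n≤1+n _))
∣pΔq∣≤∣p∣+∣q∣ (true  ∷ p) (false ∷ q) = s≤s (∣pΔq∣≤∣p∣+∣q∣ p q)
∣pΔq∣≤∣p∣+∣q∣ (false ∷ p) (true  ∷ q) =
  ≤-trans (s≤s (∣pΔq∣≤∣p∣+∣q∣ p q)) (≤-reflexive (sym (+-suc ∣ p ∣ ∣ q ∣)))
∣pΔq∣≤∣p∣+∣q∣ (false ∷ p) (false ∷ q) = ∣pΔq∣≤∣p∣+∣q∣ p q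

∣pΔr∣≤∣pΔq∣+∣qΔr∣ : ∀ (p q r : Subset n) → ∣ p Δ r ∣ ≤ ∣ p Δ q ∣ + ∣ q Δ r ∣
∣pΔr∣≤∣pΔq∣+∣qΔr∣ p q r = begin
  ∣ p Δ r ∣                ≡⟨ cong ∣_∣ (Δ-cancel-middle p q r) ⟨
  ∣ (p Δ q) Δ (q Δ r) ∣    ≤⟨ ∣pΔq∣≤∣p∣+∣q∣ (p Δ q) (q Δ r) ⟩
  ∣ p Δ q ∣ + ∣ q Δ r ∣    ∎
  where open ≤-Reasoning

∣p∣≤suc∣pΔ⁅x⁆∣ : ∀ (p : Subset n) (x : Fin n) → ∣ p ∣ ≤ suc ∣ p Δ ⁅ x ⁆ ∣
∣p∣≤suc∣pΔ⁅x⁆∣ p x with x ∈? p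
... | yes x∈p = ≤-reflexive (sym (x∈p⇒suc∣pΔ⁅x⁆∣≡∣p∣ p x∈p))
... | no  x∉p = ≤-trans (n≤1+n ∣ p ∣) (≤-trans (≤-reflexive (sym (x∉p⇒∣pΔ⁅x⁆∣≡suc∣p∣ p x∉p))) (n≤1+n _))

∣pΔ⁅x⁆∣≤suc∣p∣ : ∀ (p : Subset n) (x : Fin n) → ∣ p Δ ⁅ x ⁆ ∣ ≤ suc ∣ p ∣
∣pΔ⁅x⁆∣≤suc∣p∣ p x with x ∈? p
... | yes x∈p = ≤-trans (n≤1+n _) (≤-trans (≤-reflexive (x∈p⇒suc∣pΔ⁅x⁆∣≡∣p∣ p x∈p)) (n≤1+n ∣ p ∣))
... | no  x∉p = ≤-reflexive (x∉p⇒∣pΔ⁅x⁆∣≡suc∣p∣ p x∉p)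

toggle-∈ : ∀ (p q : Subset n) → x ∈ p Δ q → suc ∣ (p Δ ⁅ x ⁆) Δ q ∣ ≡ ∣ p Δ q ∣
toggle-∈ {x = x} p q x∈ = trans (cong (suc ∘ ∣_∣) (Δ-swap p ⁅ x ⁆ q)) (x∈p⇒suc∣pΔ⁅x⁆∣≡∣p∣ (p Δ q) x∈)

toggle-∉ : ∀ (p q : Subset n) → x ∉ p Δ q → ∣ (p Δ ⁅ x ⁆) Δ q ∣ ≡ suc ∣ p Δ q ∣
toggle-∉ {x = x} p q x∉ = trans (cong ∣_∣ (Δ-swap p ⁅ x ⁆ q)) (x∉p⇒∣pΔ⁅x⁆∣≡suc∣p∣ (p Δ q) x∉)

toggle-≢ : ∀ (p q : Subset n) → y ≢ x → y ∈ p Δ q → y ∈ (p Δ ⁅ x ⁆) Δ q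
toggle-≢ {x = x} p q y≢x y∈ =
  subst (_ ∈_) (sym (Δ-swap p ⁅ x ⁆ q)) (x∈p∧x∉q⇒x∈pΔq (p Δ q) ⁅ x ⁆ y∈ (x≢y⇒x∉⁅y⁆ y≢x))

module _ {C B : Set} {_∙_ : C → C → C} (∙-sel : Selective _≡_ _∙_) (f : B → C) where

  foldr-selective : ∀ b xs → foldr (λ y m → f y ∙ m) b xs ≡ b
                             ⊎ ∃ λ y → y ∈ₗ xs × foldr (λ y m → f y ∙ m) b xs ≡ f y
  foldr-selective b []       = inj₁ refl
  foldr-selective b (y ∷ ys) with ∙-sel (f y) (foldr (λ y m → f y ∙ m) b ys) | foldr-selective b ys
  ... | inj₁ ≡fy   | _                     = inj₂ (y , here refl , ≡fy)
  ... | inj₂ ≡rest | inj₁ ≡b               = inj₁ (trans ≡rest ≡b)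
  ... | inj₂ ≡rest | inj₂ (x , x∈ys , ≡fx) = inj₂ (x , there x∈ys , trans ≡rest ≡fx)

module _ {B : Set} (f : B → ℕ) where

  f≤foldr-⊔ : ∀ {x xs} → x ∈ₗ xs → f x ≤ foldr (λ y m → f y ⊔ m) 0 xs
  f≤foldr-⊔ {xs = y ∷ _} (here refl) = m≤m⊔n (f y) _
  f≤foldr-⊔ {xs = y ∷ _} (there x∈)  = ≤-trans (f≤foldr-⊔ x∈) (m≤n⊔m (f y) _)

  foldr-⊓≤f : ∀ {b x xs} → x ∈ₗ xs → foldr (λ y m → f y ⊓ m) b xs ≤ f x
  foldr-⊓≤f {xs = y ∷ _} (here refl) = m⊓n≤m (f y) _
  foldr-⊓≤f {xs = y ∷ _} (there x∈)  = ≤-trans (m⊓n≤n (f y) _) (foldr-⊓≤f x∈)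

  foldr-⊔-attained : ∀ {x xs} → x ∈ₗ xs → ∃ λ y → y ∈ₗ xs × foldr (λ y m → f y ⊔ m) 0 xs ≡ f y
  foldr-⊔-attained {x} {xs} x∈ with foldr-selective ⊔-sel f 0 xs
  ... | inj₂ attained = attained
  ... | inj₁ ≡0       = x , x∈ , trans ≡0 (sym (n≤0⇒n≡0 (≤-trans (f≤foldr-⊔ x∈) (≤-reflexive ≡0))))

  foldr-⊓-attained : ∀ {b x xs} → (∀ y → f y ≤ b) → x ∈ₗ xs →
                     ∃ λ y → y ∈ₗ xs × foldr (λ y m → f y ⊓ m) b xs ≡ f y
  foldr-⊓-attained {b} {x} {xs} ≤b x∈ with foldr-selective ⊓-sel f b xs
  ... | inj₂ attained = attained
  ... | inj₁ ≡b       = x , x∈ , ≤-antisym (foldr-⊓≤f x∈) (≤-trans (≤b x) (≤-reflexive (sym ≡b)))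

∈-allSubsets : ∀ (A : Subset n) → A ∈ₗ allSubsets n
∈-allSubsets []          = here refl
∈-allSubsets (true  ∷ A) = ∈-++⁺ˡ (∈-map⁺ (true ∷_) (∈-allSubsets A))
∈-allSubsets (false ∷ A) = ∈-++⁺ʳ (map (true ∷_) (allSubsets _)) (∈-map⁺ (false ∷_) (∈-allSubsets A))

MonotoneChain : (Subset n → ℕ) → Subset n → List (Fin n) → Set
MonotoneChain f A es = (i : ℕ) → i < length es →
  f (A ∪ setOf (take i es)) ≤ f (A ∪ setOf (take (suc i) es))

monotoneChain-∷ : ∀ (f : Subset n → ℕ) {A e es} → f A ≤ f (A ∪ ⁅ e ⁆) →
                  MonotoneChain f (A ∪ ⁅ e ⁆) es → MonotoneChain f A (e ∷ es)
monotoneChain-∷ f {A} {e} first rest zero _ =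
  subst₂ (λ B C → f B ≤ f C) (sym (∪-identityʳ A)) (cong (A ∪_) (sym (∪-identityʳ ⁅ e ⁆))) first
monotoneChain-∷ f {A} {e} {es} first rest (suc i) (s≤s i<) =
  subst₂ (λ B C → f B ≤ f C)
    (∪-assoc A ⁅ e ⁆ (setOf (take i es))) (∪-assoc A ⁅ e ⁆ (setOf (take (suc i) es))) (rest i i<)

module Twists {n : ℕ} (𝓕 : SetSystem n) where

  rmaxΔ rminΔ ωΔ : Subset n → ℕ
  rmaxΔ A = rmax (twist 𝓕 A)
  rminΔ A = rmin (twist 𝓕 A)
  ωΔ    A = width (twist 𝓕 A)

  Smallest Largest : Subset n → Subset n → Set
  Smallest A Z = Feasible 𝓕 Z × ∣ Z Δ A ∣ ≡ rminΔ A
  Largest  A W = Feasible 𝓕 W × ∣ W Δ A ∣ ≡ rmaxΔ A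

  private
    variable
      A X Z : Subset n

  ∣ZΔA∣≤rmaxΔ : Feasible 𝓕 Z → ∣ Z Δ A ∣ ≤ rmaxΔ A
  ∣ZΔA∣≤rmaxΔ {A = A} Z∈ = f≤foldr-⊔ ∣_∣ (∈-map⁺ (_Δ A) Z∈)

  rminΔ≤∣ZΔA∣ : Feasible 𝓕 Z → rminΔ A ≤ ∣ Z Δ A ∣
  rminΔ≤∣ZΔA∣ {A = A} Z∈ = foldr-⊓≤f ∣_∣ (∈-map⁺ (_Δ A) Z∈)

  largest-exists : Feasible 𝓕 X → ∀ A → ∃ (Largest A)
  largest-exists X∈ A with foldr-⊔-attained ∣_∣ (∈-map⁺ (_Δ A) X∈)
  ... | _ , W∈ΔA , ≡∣WΔA∣ with ∈-map⁻ (_Δ A) W∈ΔA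
  ...   | W , W∈ , refl = W , W∈ , sym ≡∣WΔA∣

  smallest-exists : Feasible 𝓕 X → ∀ A → ∃ (Smallest A)
  smallest-exists X∈ A with foldr-⊓-attained ∣_∣ ∣p∣≤n (∈-map⁺ (_Δ A) X∈)
  ... | _ , Z∈ΔA , ≡∣ZΔA∣ with ∈-map⁻ (_Δ A) Z∈ΔA
  ...   | Z , Z∈ , refl = Z , Z∈ , sym ≡∣ZΔA∣

  rminΔ-feasible : Feasible 𝓕 Z → rminΔ Z ≡ 0
  rminΔ-feasible {Z} Z∈ = n≤0⇒n≡0 (begin
    rminΔ Z    ≤⟨ rminΔ≤∣ZΔA∣ Z∈ ⟩
    ∣ Z Δ Z ∣  ≡⟨ cong ∣_∣ (Δ-self Z) ⟩
    ∣ ⊥ {n} ∣  ≡⟨ ∣⊥∣≡0 n ⟩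
    0          ∎)
    where open ≤-Reasoning

  ωΔ-feasible : Feasible 𝓕 Z → ωΔ Z ≡ rmaxΔ Z
  ωΔ-feasible {Z} Z∈ = cong (rmaxΔ Z ∸_) (rminΔ-feasible Z∈)

  ωΔ≤maxTwistWidth : ∀ A → ωΔ A ≤ maxTwistWidth 𝓕
  ωΔ≤maxTwistWidth A = f≤foldr-⊔ ωΔ (∈-allSubsets A)

  maxTwistWidth-attained : ∃ λ A → maxTwistWidth 𝓕 ≡ ωΔ A
  maxTwistWidth-attained with foldr-⊔-attained ωΔ (∈-allSubsets (⊥ {n}))
  ... | A , _ , ≡ωΔA = A , ≡ωΔA

  smallest-∈⇒ωΔ-mono : ∀ {A Z e} → Smallest A Z → e ∈ Z Δ A → ωΔ A ≤ ωΔ (A Δ ⁅ e ⁆)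
  smallest-∈⇒ωΔ-mono {A} {Z} {e} (Z∈ , ∣ZΔA∣≡) e∈ZΔA with largest-exists Z∈ A
  ... | W , W∈ , ∣WΔA∣≡ = ∸-mono rmaxΔ-drops-≤1 rminΔ-drops
    where
    open ≤-Reasoning
    A' = A Δ ⁅ e ⁆
    rmaxΔ-drops-≤1 : rmaxΔ A ≤ suc (rmaxΔ A')
    rmaxΔ-drops-≤1 = begin
      rmaxΔ A                  ≡⟨ ∣WΔA∣≡ ⟨
      ∣ W Δ A ∣                ≤⟨ ∣p∣≤suc∣pΔ⁅x⁆∣ (W Δ A) e ⟩
      suc ∣ (W Δ A) Δ ⁅ e ⁆ ∣  ≡⟨ cong (suc ∘ ∣_∣) (Δ-assoc W A ⁅ e ⁆) ⟩
      suc ∣ W Δ A' ∣           ≤⟨ s≤s (∣ZΔA∣≤rmaxΔ W∈) ⟩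
      suc (rmaxΔ A')           ∎
    rminΔ-drops : suc (rminΔ A') ≤ rminΔ A
    rminΔ-drops = begin
      suc (rminΔ A')           ≤⟨ s≤s (rminΔ≤∣ZΔA∣ Z∈) ⟩
      suc ∣ Z Δ A' ∣           ≡⟨ cong (suc ∘ ∣_∣) (Δ-assoc Z A ⁅ e ⁆) ⟨
      suc ∣ (Z Δ A) Δ ⁅ e ⁆ ∣  ≡⟨ x∈p⇒suc∣pΔ⁅x⁆∣≡∣p∣ (Z Δ A) e∈ZΔA ⟩
      ∣ Z Δ A ∣                ≡⟨ ∣ZΔA∣≡ ⟩
      rminΔ A                  ∎

  largest-∉⇒ωΔ-mono : ∀ {A W e} → Largest A W → e ∉ W Δ A → ωΔ A ≤ ωΔ (A Δ ⁅ e ⁆)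
  largest-∉⇒ωΔ-mono {A} {W} {e} (W∈ , ∣WΔA∣≡) e∉WΔA with smallest-exists W∈ A
  ... | Z , Z∈ , ∣ZΔA∣≡ = ∸-mono rmaxΔ-grows rminΔ-grows-≤1
    where
    open ≤-Reasoning
    A' = A Δ ⁅ e ⁆
    rmaxΔ-grows : suc (rmaxΔ A) ≤ rmaxΔ A'
    rmaxΔ-grows = begin
      suc (rmaxΔ A)            ≡⟨ cong suc ∣WΔA∣≡ ⟨
      suc ∣ W Δ A ∣            ≡⟨ x∉p⇒∣pΔ⁅x⁆∣≡suc∣p∣ (W Δ A) e∉WΔA ⟨
      ∣ (W Δ A) Δ ⁅ e ⁆ ∣      ≡⟨ cong ∣_∣ (Δ-assoc W A ⁅ e ⁆) ⟩
      ∣ W Δ A' ∣               ≤⟨ ∣ZΔA∣≤rmaxΔ W∈ ⟩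
      rmaxΔ A'                 ∎
    rminΔ-grows-≤1 : rminΔ A' ≤ suc (rminΔ A)
    rminΔ-grows-≤1 = begin
      rminΔ A'                 ≤⟨ rminΔ≤∣ZΔA∣ Z∈ ⟩
      ∣ Z Δ A' ∣               ≡⟨ cong ∣_∣ (Δ-assoc Z A ⁅ e ⁆) ⟨
      ∣ (Z Δ A) Δ ⁅ e ⁆ ∣      ≤⟨ ∣pΔ⁅x⁆∣≤suc∣p∣ (Z Δ A) e ⟩
      suc ∣ Z Δ A ∣            ≡⟨ cong suc ∣ZΔA∣≡ ⟩
      suc (rminΔ A)            ∎

  NonNarrowing : Subset n → Fin n → Set
  NonNarrowing A e = (∃ λ Z → Smallest A Z × e ∈ Z Δ A) ⊎ (∃ λ W → Largest A W × e ∉ W Δ A)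

  nonNarrowing? : ∀ A e → Dec (NonNarrowing A e)
  nonNarrowing? A e =
    search (λ Z → ∣ Z Δ A ∣ ≟ℕ rminΔ A) (λ Z → e ∈? Z Δ A)
    ⊎-dec search (λ W → ∣ W Δ A ∣ ≟ℕ rmaxΔ A) (λ W → ¬? (e ∈? W Δ A))
    where
    search : ∀ {P Q : Subset n → Set} → (∀ Z → Dec (P Z)) → (∀ Z → Dec (Q Z)) →
             Dec (∃ λ Z → (Feasible 𝓕 Z × P Z) × Q Z)
    search {P} {Q} P? Q? =
      map′ (λ found → let Z , Z∈ , pZ , qZ = find {P = λ Z → P Z × Q Z} found in Z , (Z∈ , pZ) , qZ)
           (λ (Z , (Z∈ , pZ) , qZ) → lose Z∈ (pZ , qZ))
           (anyₗ? (λ Z → P? Z ×-dec Q? Z) 𝓕)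

  nonNarrowing⇒ωΔ-mono : ∀ {A e} → NonNarrowing A e → ωΔ A ≤ ωΔ (A Δ ⁅ e ⁆)
  nonNarrowing⇒ωΔ-mono (inj₁ (_ , sZ , e∈ZΔA)) = smallest-∈⇒ωΔ-mono sZ e∈ZΔA
  nonNarrowing⇒ωΔ-mono (inj₂ (_ , lW , e∉WΔA)) = largest-∉⇒ωΔ-mono lW e∉WΔA

  record WideningChain (X A : Subset n) : Set where
    field
      elems    : List (Fin n)
      unique   : Unique elems
      fresh    : All (_∉ A) elems
      feasible : Feasible 𝓕 (A ∪ setOf elems)
      wider    : ωΔ X ≤ ωΔ (A ∪ setOf elems)
      monotone : MonotoneChain ωΔ A elems

  wideningChain-∷ : ∀ {X A e} → e ∉ A → ωΔ A ≤ ωΔ (A ∪ ⁅ e ⁆) →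
                    WideningChain X (A ∪ ⁅ e ⁆) → WideningChain X A
  wideningChain-∷ {X} {A} {e} e∉A widens chain = record
    { elems    = e ∷ elems
    ; unique   = All.map (λ x∉ e≡x → x∉ (q⊆p∪q A ⁅ e ⁆ (subst (_∈ ⁅ e ⁆) e≡x (x∈⁅x⁆ e)))) fresh ∷ unique
    ; fresh    = e∉A ∷ All.map (_∘ p⊆p∪q ⁅ e ⁆) fresh
    ; feasible = subst (Feasible 𝓕) (∪-assoc A ⁅ e ⁆ (setOf elems)) feasible
    ; wider    = subst (λ B → ωΔ X ≤ ωΔ B) (∪-assoc A ⁅ e ⁆ (setOf elems)) wider
    ; monotone = monotoneChain-∷ ωΔ widens monotone
    }
    where open WideningChain chain

  module _ (dm : IsDeltaMatroid 𝓕) where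

    -- Minimality of Z forces the exchange partner v of u to differ from u and to lie outside
    -- (Z Δ ⁅ u ⁆) Δ A, so toggling u and v keeps Z smallest and moves it two steps towards F.
    exchange-step : ∀ {A Z F u} → Smallest A Z → Feasible 𝓕 F → u ∈ Z Δ A → u ∉ F Δ A →
                    ∃ λ Z' → Smallest A Z' × ∣ Z' Δ F ∣ < ∣ Z Δ F ∣
    exchange-step {A} {Z} {F} {u} (Z∈ , ∣ZΔA∣≡) F∈ u∈ZΔA u∉FΔA =
      improve (proj₂ dm Z F Z∈ F∈ u u∈ZΔF)
      where
      u∈ZΔF : u ∈ Z Δ F
      u∈ZΔF = subst (u ∈_) (Δ-cancelʳ Z F A) (x∈p∧x∉q⇒x∈pΔq (Z Δ A) (F Δ A) u∈ZΔA u∉FΔA)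
      Z₁ = Z Δ ⁅ u ⁆
      suc∣Z₁ΔA∣≡rminΔ : suc ∣ Z₁ Δ A ∣ ≡ rminΔ A
      suc∣Z₁ΔA∣≡rminΔ = trans (toggle-∈ Z A u∈ZΔA) ∣ZΔA∣≡
      improve : (Σ (Fin n) λ v → v ∈ Z Δ F × Feasible 𝓕 (Z Δ (⁅ u ⁆ ∪ ⁅ v ⁆))) →
                ∃ λ Z' → Smallest A Z' × ∣ Z' Δ F ∣ < ∣ Z Δ F ∣
      improve (v , v∈ZΔF , Z∆uv∈) with v ≟ u
      ... | yes refl = ⊥-elim (1+n≰n (≤-trans (≤-reflexive suc∣Z₁ΔA∣≡rminΔ) (rminΔ≤∣ZΔA∣ Z₁∈)))
        where
        Z₁∈ : Feasible 𝓕 Z₁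
        Z₁∈ = subst (λ S → Feasible 𝓕 (Z Δ S)) (∪-idem ⁅ u ⁆) Z∆uv∈
      ... | no v≢u = Z₂ , (Z₂∈ , ∣Z₂ΔA∣≡) , ∣Z₂ΔF∣<∣ZΔF∣
        where
        Z₂ = Z₁ Δ ⁅ v ⁆
        Z₂∈ : Feasible 𝓕 Z₂
        Z₂∈ = subst (Feasible 𝓕)
          (trans (cong (Z Δ_) (x≢y⇒⁅x⁆∪⁅y⁆≡⁅x⁆Δ⁅y⁆ (v≢u ∘ sym))) (sym (Δ-assoc Z ⁅ u ⁆ ⁅ v ⁆))) Z∆uv∈
        v∉Z₁ΔA : v ∉ Z₁ Δ A
        v∉Z₁ΔA v∈Z₁ΔA = 1+n≰n (≤-trans (n≤1+n _) (begin
          suc (suc ∣ Z₂ Δ A ∣)  ≡⟨ cong suc (toggle-∈ Z₁ A v∈Z₁ΔA) ⟩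
          suc ∣ Z₁ Δ A ∣        ≡⟨ suc∣Z₁ΔA∣≡rminΔ ⟩
          rminΔ A               ≤⟨ rminΔ≤∣ZΔA∣ Z₂∈ ⟩
          ∣ Z₂ Δ A ∣            ∎))
          where open ≤-Reasoning
        ∣Z₂ΔA∣≡ : ∣ Z₂ Δ A ∣ ≡ rminΔ A
        ∣Z₂ΔA∣≡ = trans (toggle-∉ Z₁ A v∉Z₁ΔA) suc∣Z₁ΔA∣≡rminΔ
        ∣Z₂ΔF∣<∣ZΔF∣ : ∣ Z₂ Δ F ∣ < ∣ Z Δ F ∣
        ∣Z₂ΔF∣<∣ZΔF∣ = begin-strict
          ∣ Z₂ Δ F ∣        <⟨ n<1+n _ ⟩
          suc ∣ Z₂ Δ F ∣    ≡⟨ toggle-∈ Z₁ F (toggle-≢ Z F v≢u v∈ZΔF) ⟩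
          ∣ Z₁ Δ F ∣        <⟨ n<1+n _ ⟩
          suc ∣ Z₁ Δ F ∣    ≡⟨ toggle-∈ Z F u∈ZΔF ⟩
          ∣ Z Δ F ∣         ∎
          where open ≤-Reasoning

    smallest-⊆ : ∀ A {F} → Feasible 𝓕 F → ∃ λ Z → Smallest A Z × Z Δ A ⊆ F Δ A
    smallest-⊆ A {F} F∈ with smallest-exists F∈ A
    ... | _ , sZ = descend sZ (<-wellFounded _)
      where
      descend : ∀ {Z} → Smallest A Z → Acc _<_ ∣ Z Δ F ∣ → ∃ λ Z' → Smallest A Z' × Z' Δ A ⊆ F Δ A
      descend {Z} sZ (acc rs) with ⊆-or-witness (Z Δ A) (F Δ A)
      ... | inj₁ ZΔA⊆FΔA = Z , sZ , ZΔA⊆FΔA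
      ... | inj₂ (u , u∈ZΔA , u∉FΔA) with exchange-step sZ F∈ u∈ZΔA u∉FΔA
      ...   | _ , sZ' , closer = descend sZ' (rs closer)

    -- Twisting by ∁ A turns largest sets into smallest ones: ∣ Z Δ ∁ A ∣ ≡ n ∸ ∣ Z Δ A ∣.
    largest-⊇ : ∀ A {F} → Feasible 𝓕 F → ∃ λ W → Largest A W × F Δ A ⊆ W Δ A
    largest-⊇ A {F} F∈ with smallest-⊆ (∁ A) F∈ | largest-exists F∈ A
    ... | W , (W∈ , ∣WΔ∁A∣≡) , WΔ∁A⊆FΔ∁A | Y , Y∈ , ∣YΔA∣≡ =
      W , (W∈ , ≤-antisym (∣ZΔA∣≤rmaxΔ W∈) rmaxΔ≤∣WΔA∣) , FΔA⊆WΔA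
      where
      FΔA⊆WΔA : F Δ A ⊆ W Δ A
      FΔA⊆WΔA = ∁p⊆∁q⇒p⊇q (subst₂ _⊆_ (Δ-∁ W A) (Δ-∁ F A) WΔ∁A⊆FΔ∁A)
      rmaxΔ≤∣WΔA∣ : rmaxΔ A ≤ ∣ W Δ A ∣
      rmaxΔ≤∣WΔA∣ = subst (_≤ ∣ W Δ A ∣) ∣YΔA∣≡ (∸-cancelʳ-≤ (∣p∣≤n (Y Δ A)) (begin
        n ∸ ∣ W Δ A ∣  ≡⟨ ∣pΔ∁q∣≡n∸∣pΔq∣ W A ⟨
        ∣ W Δ ∁ A ∣    ≡⟨ ∣WΔ∁A∣≡ ⟩
        rminΔ (∁ A)    ≤⟨ rminΔ≤∣ZΔA∣ Y∈ ⟩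
        ∣ Y Δ ∁ A ∣    ≡⟨ ∣pΔ∁q∣≡n∸∣pΔq∣ Y A ⟩
        n ∸ ∣ Y Δ A ∣  ∎))
        where open ≤-Reasoning

    smallest-disjoint⇒feasible : ∀ {A X} → Feasible 𝓕 X →
      (∀ {Z} → Smallest A Z → ∀ {e} → e ∈ X Δ A → e ∉ Z Δ A) → Feasible 𝓕 A
    smallest-disjoint⇒feasible {A} X∈ disjoint with smallest-⊆ A X∈
    ... | Z , sZ@(Z∈ , _) , ZΔA⊆XΔA = subst (Feasible 𝓕) (Δ≡⊥⇒≡ Z A (Empty-unique ZΔA-empty)) Z∈
      where
      ZΔA-empty : Empty (Z Δ A)
      ZΔA-empty (e , e∈ZΔA) = disjoint sZ (ZΔA⊆XΔA e∈ZΔA) e∈ZΔA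

    largest-⊇⇒rmaxΔ-≤ : ∀ {A X} → Feasible 𝓕 X →
      (∀ {W} → Largest A W → X Δ A ⊆ W Δ A) → rmaxΔ X ≤ rmaxΔ A
    largest-⊇⇒rmaxΔ-≤ {A} {X} X∈ covers with largest-exists X∈ X
    ... | Y , Y∈ , ∣YΔX∣≡ with largest-⊇ A Y∈
    ...   | W , lW@(_ , ∣WΔA∣≡) , YΔA⊆WΔA = begin
      rmaxΔ X                ≡⟨ ∣YΔX∣≡ ⟨
      ∣ Y Δ X ∣              ≡⟨ cong ∣_∣ (Δ-cancelʳ Y X A) ⟨
      ∣ (Y Δ A) Δ (X Δ A) ∣  ≤⟨ p⊆q⇒∣p∣≤∣q∣ (p⊆r∧q⊆r⇒pΔq⊆r (Y Δ A) (X Δ A) YΔA⊆WΔA (covers lW)) ⟩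
      ∣ W Δ A ∣              ≡⟨ ∣WΔA∣≡ ⟩
      rmaxΔ A                ∎
      where open ≤-Reasoning

    ¬nonNarrowing⇒feasible-wider : ∀ {A X} → Feasible 𝓕 X → (∀ {e} → e ∈ X Δ A → ¬ NonNarrowing A e) →
                             Feasible 𝓕 A × ωΔ X ≤ ωΔ A
    ¬nonNarrowing⇒feasible-wider {A} {X} X∈ ¬nonNarrowing = A∈ , (begin
      ωΔ X     ≡⟨ ωΔ-feasible X∈ ⟩
      rmaxΔ X  ≤⟨ largest-⊇⇒rmaxΔ-≤ X∈ covers ⟩
      rmaxΔ A  ≡⟨ ωΔ-feasible A∈ ⟨
      ωΔ A     ∎)
      where
      open ≤-Reasoning
      A∈ : Feasible 𝓕 A
      A∈ = smallest-disjoint⇒feasible X∈ λ sZ e∈XΔA e∈ZΔA → ¬nonNarrowing e∈XΔA (inj₁ (_ , sZ , e∈ZΔA))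
      covers : ∀ {W} → Largest A W → X Δ A ⊆ W Δ A
      covers {W} lW {e} e∈XΔA =
        decidable-stable (e ∈? W Δ A) λ e∉WΔA → ¬nonNarrowing e∈XΔA (inj₂ (_ , lW , e∉WΔA))

    wideningChain : ∀ {X A} → Feasible 𝓕 X → A ⊆ X → WideningChain X A
    wideningChain {X} X∈ A⊆X = grow A⊆X (<-wellFounded _)
      where
      grow : ∀ {A} → A ⊆ X → Acc _<_ ∣ X Δ A ∣ → WideningChain X A
      grow {A} A⊆X (acc rs) with any? (λ e → e ∈? X Δ A ×-dec nonNarrowing? A e)
      ... | no ∄e = record
        { elems    = []
        ; unique   = []
        ; fresh    = []
        ; feasible = subst (Feasible 𝓕) (sym (∪-identityʳ A)) (proj₁ A∈×ωΔX≤ωΔA)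
        ; wider    = subst (λ B → ωΔ X ≤ ωΔ B) (sym (∪-identityʳ A)) (proj₂ A∈×ωΔX≤ωΔA)
        ; monotone = λ _ ()
        }
        where
        A∈×ωΔX≤ωΔA : Feasible 𝓕 A × ωΔ X ≤ ωΔ A
        A∈×ωΔX≤ωΔA = ¬nonNarrowing⇒feasible-wider X∈ λ e∈XΔA widens → ∄e (_ , e∈XΔA , widens)
      ... | yes (e , e∈XΔA , widens) =
        wideningChain-∷ e∉A (subst (λ B → ωΔ A ≤ ωΔ B) (sym A∪⁅e⁆≡AΔ⁅e⁆) (nonNarrowing⇒ωΔ-mono widens))
          (grow (p⊆q∧x∈q⇒p∪⁅x⁆⊆q A⊆X e∈X) (rs closer))
        where
        e∈X×e∉A : e ∈ X × e ∉ A
        e∈X×e∉A = p⊆q∧x∈qΔp⇒x∈q∧x∉p A⊆X e∈XΔA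
        e∈X = proj₁ e∈X×e∉A
        e∉A = proj₂ e∈X×e∉A
        A∪⁅e⁆≡AΔ⁅e⁆ : A ∪ ⁅ e ⁆ ≡ A Δ ⁅ e ⁆
        A∪⁅e⁆≡AΔ⁅e⁆ = x∉p⇒p∪⁅x⁆≡pΔ⁅x⁆ A e∉A
        closer : ∣ X Δ (A ∪ ⁅ e ⁆) ∣ < ∣ X Δ A ∣
        closer = ≤-reflexive (begin
          suc ∣ X Δ (A ∪ ⁅ e ⁆) ∣  ≡⟨ cong (λ B → suc ∣ X Δ B ∣) A∪⁅e⁆≡AΔ⁅e⁆ ⟩
          suc ∣ X Δ (A Δ ⁅ e ⁆) ∣  ≡⟨ cong (suc ∘ ∣_∣) (Δ-assoc X A ⁅ e ⁆) ⟨
          suc ∣ (X Δ A) Δ ⁅ e ⁆ ∣  ≡⟨ x∈p⇒suc∣pΔ⁅x⁆∣≡∣p∣ (X Δ A) e∈XΔA ⟩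
          ∣ X Δ A ∣                ∎)
          where open ≡-Reasoning

  maxTwistWidth-feasible : ∀ {X₀} → Feasible 𝓕 X₀ → ∃ λ X → Feasible 𝓕 X × ωΔ X ≡ maxTwistWidth 𝓕
  maxTwistWidth-feasible X₀∈ with maxTwistWidth-attained
  ... | A , max≡ωΔA with smallest-exists X₀∈ A | largest-exists X₀∈ A
  ...   | Z , Z∈ , ∣ZΔA∣≡ | W , W∈ , ∣WΔA∣≡ = Z , Z∈ , ≤-antisym (ωΔ≤maxTwistWidth Z) (begin
    maxTwistWidth 𝓕        ≡⟨ max≡ωΔA ⟩
    rmaxΔ A ∸ rminΔ A      ≡⟨ cong₂ _∸_ ∣WΔA∣≡ ∣ZΔA∣≡ ⟨
    ∣ W Δ A ∣ ∸ ∣ Z Δ A ∣  ≤⟨ m≤n+o⇒m∸n≤o ∣ W Δ A ∣ ∣ Z Δ A ∣ triangle ⟩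
    ∣ W Δ Z ∣              ≤⟨ ∣ZΔA∣≤rmaxΔ W∈ ⟩
    rmaxΔ Z                ≡⟨ ωΔ-feasible Z∈ ⟨
    ωΔ Z                   ∎)
    where
    open ≤-Reasoning
    triangle : ∣ W Δ A ∣ ≤ ∣ Z Δ A ∣ + ∣ W Δ Z ∣
    triangle = ≤-trans (∣pΔr∣≤∣pΔq∣+∣qΔr∣ W Z A) (≤-reflexive (+-comm ∣ W Δ Z ∣ ∣ Z Δ A ∣))

mainTheorem3 : (n : ℕ) (𝓕 : SetSystem n) → IsDeltaMatroid 𝓕 →
    Σ (List (Fin n)) λ es →
      Unique es ×
      Feasible 𝓕 (setOf es) ×
      width (twist 𝓕 (setOf es)) ≡ maxTwistWidth 𝓕 ×
      ((i : ℕ) → i < length es →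
        width (twist 𝓕 (setOf (take i es))) ≤ width (twist 𝓕 (setOf (take (suc i) es))))
mainTheorem3 n 𝓕 dm@((_ , X₀∈) , _) =
  let X , X∈ , ωΔX≡max = maxTwistWidth-feasible X₀∈
      open WideningChain (wideningChain dm X∈ ⊥⊆)
  in elems , unique , subst (Feasible 𝓕) (∪-identityˡ (setOf elems)) feasible ,
     ≤-antisym (ωΔ≤maxTwistWidth (setOf elems))
       (subst₂ _≤_ ωΔX≡max (cong ωΔ (∪-identityˡ (setOf elems))) wider) ,
     λ i i< → subst₂ (λ B C → ωΔ B ≤ ωΔ C)
       (∪-identityˡ (setOf (take i elems))) (∪-identityˡ (setOf (take (suc i) elems))) (monotone i i<)
  where open Twists 𝓕
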